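{- Let $\mu$ be a multiplicity on $\mathcal{A}$. Then $\phi_q(D(\mathcal{A},\mu))=D(\mathcal{A},q\mu)\cap\operatorname{Im}\phi_q$.
   Context: Let $q=p^d$ be a prime power, $S=\mathbb{F}_q[x_1,\dots,x_\ell]$ and $\mathrm{Der}_S=\bigoplus_{i=1}^\ell S\partial_{x_i}$. Let $\mathcal{A}$ be a finite set of linear hyperplanes in $\mathbb{F}_q^\ell$; for $H\in\mathcal{A}$ fix a linear form $\alpha_H$ with coefficients in $\mathbb{F}_q$ and $H=\ker\alpha_H$. A multiplicity is a map $\mu:\mathcal{A}\to\mathbb{Z}_{\ge0}$, and $D(\mathcal{A},\mu)=\{\theta\in\mathrm{Der}_S:\theta(\alpha_H)\in\alpha_H^{\mu(H)}S\ \text{for all } H\in\mathcal{A}\}$; $q\mu$ is the multiplicity $H\mapsto q\mu(H)$. $\phi_q:S\to S$ is $f\mapsto f^q$, extended to $\mathrm{Der}_S$ by $\phi_q(\sum_i f_i\partial_{x_i})=\sum_i\phi_q(f_i)\partial_{x_i}$; $\operatorname{Im}\phi_q$ denotes the image of this map on $\mathrm{Der}_S$. -}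

module Defs where

open import Level using (_⊔_)
open import Algebra.Bundles using (CommutativeRing)
open import Data.Nat using (ℕ; zero; suc; _≤_; _^_)
open import Data.Nat.Primality using (Prime)
open import Data.Fin using (Fin)
import Data.Fin as Fin
open import Data.Vec using (Vec; tabulate; zipWith; replicate)
open import Data.Vec.Properties using (≡-dec)
import Data.Nat as ℕ
open import Data.List using (List; []; _∷_; _++_; map; concatMap; concat)
import Data.List as List
open import Data.Product using (Σ; _×_; _,_)
open import Data.Bool using (if_then_else_)
open import Relation.Nullary using (¬_)
open import Relation.Nullary.Decidable using (⌊_⌋)
open import Relation.Binary.PropositionalEquality using (_≡_)

IsPrimePower : ℕ → Set
IsPrimePower q = Σ ℕ λ p → Σ ℕ λ d → Prime p × (1 ≤ d) × (q ≡ p ^ d)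

module _ {c ℓ} (R : CommutativeRing c ℓ) where
  open CommutativeRing R

  record IsField : Set (c ⊔ ℓ) where
    field
      0≉1     : ¬ (0# ≈ 1#)
      inverse : ∀ x → ¬ (x ≈ 0#) → Σ Carrier λ y → x * y ≈ 1#

  HasCard : ℕ → Set (c ⊔ ℓ)
  HasCard n = Σ (Fin n → Carrier) λ e →
                (∀ i j → e i ≈ e j → i ≡ j) × (∀ x → Σ (Fin n) λ i → e i ≈ x)

module Polys {c ℓ} (R : CommutativeRing c ℓ) (l : ℕ) where
  open CommutativeRing R

  Monomial : Set
  Monomial = Vec ℕ l

  -- a polynomial is a finite formal sum of terms a·x^e
  Poly : Set c
  Poly = List (Carrier × Monomial)

  coeff : Poly → Monomial → Carrier
  coeff [] m = 0#
  coeff ((a , e) ∷ f) m =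
    if ⌊ ≡-dec ℕ._≟_ e m ⌋ then a + coeff f m else coeff f m

  _≈ₚ_ : Poly → Poly → Set ℓ
  f ≈ₚ g = ∀ m → coeff f m ≈ coeff g m

  1ₚ : Poly
  1ₚ = (1# , replicate l 0) ∷ []

  var : Fin l → Poly
  var i = (1# , tabulate (λ j → if ⌊ i Fin.≟ j ⌋ then 1 else 0)) ∷ []

  _+ₚ_ : Poly → Poly → Poly
  _+ₚ_ = _++_

  _*ₚ_ : Poly → Poly → Poly
  f *ₚ g = concatMap (λ { (a , e) → map (λ { (b , e′) → (a * b , zipWith ℕ._+_ e e′) }) g }) f

  _^ₚ_ : Poly → ℕ → Poly
  f ^ₚ zero = 1ₚ
  f ^ₚ suc n = f *ₚ (f ^ₚ n)

  scale : Carrier → Poly → Poly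
  scale a f = map (λ { (b , e) → (a * b , e) }) f

  _∣ₚ_ : Poly → Poly → Set (c ⊔ ℓ)
  h ∣ₚ f = Σ Poly λ g → f ≈ₚ (h *ₚ g)

  LinForm : Set c
  LinForm = Fin l → Carrier

  linPoly : LinForm → Poly
  linPoly a = concat (List.tabulate (λ i → scale (a i) (var i)))

  -- derivations Der_S = ⊕ S ∂_{x_i}, θ = Σ θ_i ∂_{x_i}
  Der : Set c
  Der = Fin l → Poly

  _≈D_ : Der → Der → Set ℓ
  θ ≈D η = ∀ i → θ i ≈ₚ η i

  applyLin : Der → LinForm → Poly
  applyLin θ a = concat (List.tabulate (λ i → scale (a i) (θ i)))

  φ : ℕ → Poly → Poly
  φ q f = f ^ₚ q

  φDer : ℕ → Der → Der
  φDer q θ i = φ q (θ i)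

  InImφ : ℕ → Der → Set (c ⊔ ℓ)
  InImφ q θ = Σ Der λ η → φDer q η ≈D θ

  -- arrangement with n hyperplanes H = ker α_H, multiplicity μ
  -- D(A, μ) membership
  InD : {n : ℕ} → (Fin n → LinForm) → (Fin n → ℕ) → Der → Set (c ⊔ ℓ)
  InD α μ θ = ∀ H → (linPoly (α H) ^ₚ μ H) ∣ₚ applyLin θ (α H)

  InφD : ℕ → {n : ℕ} → (Fin n → LinForm) → (Fin n → ℕ) → Der → Set (c ⊔ ℓ)
  InφD q α μ θ = Σ Der λ η → InD α μ η × (φDer q η ≈D θ)

  NonZeroForm : LinForm → Set ℓ
  NonZeroForm a = ¬ (∀ i → a i ≈ 0#)

  Proportional : LinForm → LinForm → Set (c ⊔ ℓ)
  Proportional a b = Σ Carrier λ t → ∀ i → a i ≈ t * b i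

{-# OPTIONS --safe #-}
-- Over F_q the q-th power map on S = F_q[x_1..x_l] is injective and, because every
-- coefficient satisfies c^q = c, it simply multiplies all exponent vectors by q.
-- Consequently φ_q commutes with evaluating a derivation at a linear form α over F_q:
-- φ_q(η)(α) = η(α)^q.  If η(α) = α^μ g then φ_q(η)(α) = α^(qμ) g^q.  Conversely, if
-- η(α)^q = (α^μ)^q h, then at exponents divisible by q the product (α^μ)^q h only sees
-- the terms of h with such exponents; these form r^q for a polynomial r, so
-- η(α)^q = (α^μ r)^q and injectivity gives η(α) = α^μ r.
module Submission where

open import Level using (Level)
open import Algebra.Bundles using (CommutativeRing; CommutativeSemiring; CommutativeMonoid)
open import Data.Bool using (if_then_else_)
open import Data.Empty using (⊥-elim)
open import Data.Fin as Fin using (Fin; fromℕ; inject₁)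
import Data.Fin.Properties as Fin
open import Data.List as List using ([]; _∷_; _++_; length)
import Data.List.Properties as List
open import Data.Nat as ℕ using (ℕ; zero; suc; z≤n; s≤s; NonZero)
open import Data.Nat.Combinatorics using (_C_; nCk+nC[k+1]≡[n+1]C[k+1]; nC1≡n; nCn≡1; k>n⇒nCk≡0)
open import Data.Nat.Divisibility as ℕ using (_∣_; divides)
import Data.Nat.DivMod as ℕ
open import Data.Nat.Primality using (Prime; euclidsLemma; ¬prime[0])
import Data.Nat.Properties as ℕ
open import Data.Nat.Tactic.RingSolver using (solve-∀)
open import Data.Product using (_,_; proj₁; proj₂)
open import Data.Sum using (inj₁; inj₂)
open import Data.Vec as Vec using (Vec; []; _∷_; zipWith; replicate)
import Data.Vec.Properties as Vec
open import Function using (_∘_; Congruent; StrictlyInverseˡ; StrictlyInverseʳ; _⇔_; mk⇔; Equivalence)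
open import Relation.Binary using (Decidable; IsEquivalence; Setoid)
open import Relation.Binary.PropositionalEquality as ≡ using (_≡_; _≢_)
import Relation.Binary.Reasoning.Setoid as SetoidReasoning
open import Relation.Nullary using (¬_; Dec; yes; no; does)
open import Relation.Nullary.Decidable using (⌊_⌋)
open import Defs

[1+k]*[1+n]C[1+k]≡[1+n]*nCk : ∀ n k → suc k ℕ.* (suc n C suc k) ≡ suc n ℕ.* (n C k)
[1+k]*[1+n]C[1+k]≡[1+n]*nCk zero zero = ≡.refl
[1+k]*[1+n]C[1+k]≡[1+n]*nCk zero (suc k)
  rewrite k>n⇒nCk≡0 {1} {2 ℕ.+ k} (s≤s (s≤s z≤n)) | k>n⇒nCk≡0 {0} {suc k} (s≤s z≤n)
  = ℕ.*-zeroʳ (2 ℕ.+ k)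
[1+k]*[1+n]C[1+k]≡[1+n]*nCk (suc n) zero =
  ≡.trans (ℕ.*-identityˡ _) (≡.trans (nC1≡n (2 ℕ.+ n)) (≡.sym (ℕ.*-identityʳ (2 ℕ.+ n))))
[1+k]*[1+n]C[1+k]≡[1+n]*nCk (suc n) (suc k) = begin
  suc (suc k) ℕ.* (suc (suc n) C suc (suc k))
    ≡⟨ ≡.cong (suc (suc k) ℕ.*_) (nCk+nC[k+1]≡[n+1]C[k+1] (suc n) (suc k)) ⟨
  suc (suc k) ℕ.* (a ℕ.+ b)
    ≡⟨ regroup (suc k) a b ⟩
  a ℕ.+ (suc k ℕ.* a ℕ.+ suc (suc k) ℕ.* b)
    ≡⟨ ≡.cong (a ℕ.+_) (≡.cong₂ ℕ._+_ ([1+k]*[1+n]C[1+k]≡[1+n]*nCk n k)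
                                    ([1+k]*[1+n]C[1+k]≡[1+n]*nCk n (suc k))) ⟩
  a ℕ.+ (suc n ℕ.* (n C k) ℕ.+ suc n ℕ.* (n C suc k))
    ≡⟨ ≡.cong (a ℕ.+_) (ℕ.*-distribˡ-+ (suc n) (n C k) (n C suc k)) ⟨
  a ℕ.+ suc n ℕ.* (n C k ℕ.+ n C suc k)
    ≡⟨ ≡.cong (λ c → a ℕ.+ suc n ℕ.* c) (nCk+nC[k+1]≡[n+1]C[k+1] n k) ⟩
  suc (suc n) ℕ.* a
    ∎
  where
  open ≡.≡-Reasoning
  a = suc n C suc k
  b = suc n C suc (suc k)
  regroup : ∀ k a b → suc k ℕ.* (a ℕ.+ b) ≡ a ℕ.+ (k ℕ.* a ℕ.+ suc k ℕ.* b)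
  regroup = solve-∀

p∣pCk : ∀ {p k} → Prime p → 0 ℕ.< k → k ℕ.< p → p ∣ p C k
p∣pCk {suc p} {suc k} p-prime _ k<p with euclidsLemma (suc k) (suc p C suc k) p-prime
  (divides (p C k) (≡.trans ([1+k]*[1+n]C[1+k]≡[1+n]*nCk p k) (ℕ.*-comm (suc p) (p C k))))
... | inj₁ p∣k+1 = ⊥-elim (ℕ.<⇒≱ k<p (ℕ.∣⇒≤ p∣k+1))
... | inj₂ p∣pCk = p∣pCk

module FreshmansDream {c ℓ} (R : CommutativeSemiring c ℓ) where
  open CommutativeSemiring R
  open import Algebra.Properties.Semiring.Exp semiring using (_^_; ^-congˡ; ^-congʳ; ^-assocʳ)
  open import Algebra.Properties.Semiring.Mult semiring using (_×_; ×-assoc-*; ×-homo-1)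
  open import Algebra.Properties.Monoid.Mult +-monoid using (×-assocˡ; ×-congʳ; ×-congˡ)
  open import Algebra.Properties.Monoid.Sum +-monoid
    using (sum; sum-init-last; sum-cong-≋; sum-replicate; sum-replicate-zero)
  open import Algebra.Properties.CommutativeSemiring.Binomial R using (theorem; binomialTerm)
  open SetoidReasoning setoid

  p×x≈0 : ∀ p → p × 1# ≈ 0# → ∀ x → p × x ≈ 0#
  p×x≈0 p p×1≈0 x = begin
    p × x               ≈⟨ ×-congʳ p (*-identityˡ x) ⟨
    p × (1# * x)        ≈⟨ ×-assoc-* p 1# x ⟨
    (p × 1#) * x        ≈⟨ *-congʳ p×1≈0 ⟩
    0# * x              ≈⟨ zeroˡ x ⟩
    0#                  ∎

  ∣⇒×≈0 : ∀ {p n} → p × 1# ≈ 0# → p ∣ n → ∀ x → n × x ≈ 0#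
  ∣⇒×≈0 {p} {n} p×1≈0 (divides k n≡k*p) x = begin
    n × x               ≈⟨ ×-congˡ n≡k*p ⟩
    (k ℕ.* p) × x       ≈⟨ ×-assocˡ x k p ⟨
    k × (p × x)         ≈⟨ ×-congʳ k (p×x≈0 p p×1≈0 x) ⟩
    k × 0#              ≈⟨ sum-replicate k ⟨
    sum {k} (λ _ → 0#)  ≈⟨ sum-replicate-zero k ⟩
    0#                  ∎

  [x+y]^p≈x^p+y^p : ∀ {p} → Prime p → p × 1# ≈ 0# → ∀ x y → (x + y) ^ p ≈ x ^ p + y ^ p
  [x+y]^p≈x^p+y^p {zero} 0-prime _ = ⊥-elim (¬prime[0] 0-prime)
  [x+y]^p≈x^p+y^p {suc m} p-prime p×1≈0 x y = begin
    (x + y) ^ p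
      ≈⟨ theorem p x y ⟩
    t Fin.zero + sum (t ∘ Fin.suc)
      ≈⟨ +-congˡ (sum-init-last (t ∘ Fin.suc)) ⟩
    t Fin.zero + (sum (t ∘ Fin.suc ∘ inject₁) + t (Fin.suc (fromℕ m)))
      ≈⟨ +-cong first (+-cong (sum-cong-≋ middle) last) ⟩
    y ^ p + (sum {m} (λ _ → 0#) + x ^ p)
      ≈⟨ +-congˡ (trans (+-congʳ (sum-replicate-zero m)) (+-identityˡ _)) ⟩
    y ^ p + x ^ p
      ≈⟨ +-comm _ _ ⟩
    x ^ p + y ^ p
      ∎
    where
    p = suc m
    t = binomialTerm x y p
    first : t Fin.zero ≈ y ^ p
    first = trans (×-homo-1 _) (*-identityˡ _)
    middle : ∀ i → t (Fin.suc (inject₁ i)) ≈ 0#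
    middle i = ∣⇒×≈0 p×1≈0 (p∣pCk p-prime (s≤s z≤n) (s≤s i<m)) _
      where i<m = ≡.subst (ℕ._< m) (≡.sym (Fin.toℕ-inject₁ i)) (Fin.toℕ<n i)
    last : t (Fin.suc (fromℕ m)) ≈ x ^ p
    last = begin
      t (Fin.suc (fromℕ m))
        ≡⟨ ≡.cong (λ j → (p C suc j) × (x ^ suc j * y ^ (m ℕ.∸ j))) (Fin.toℕ-fromℕ m) ⟩
      (p C p) × (x ^ p * y ^ (m ℕ.∸ m))  ≈⟨ ×-congˡ (nCn≡1 p) ⟩
      1 × (x ^ p * y ^ (m ℕ.∸ m))        ≈⟨ ×-homo-1 _ ⟩
      x ^ p * y ^ (m ℕ.∸ m)              ≈⟨ *-congˡ (^-congʳ y (ℕ.n∸n≡0 m)) ⟩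
      x ^ p * 1#                         ≈⟨ *-identityʳ _ ⟩
      x ^ p                              ∎

  [x+y]^pᵈ≈x^pᵈ+y^pᵈ : ∀ {p} → Prime p → p × 1# ≈ 0# →
                       ∀ d x y → (x + y) ^ (p ℕ.^ d) ≈ x ^ (p ℕ.^ d) + y ^ (p ℕ.^ d)
  [x+y]^pᵈ≈x^pᵈ+y^pᵈ p-prime p×1≈0 zero x y =
    trans (*-identityʳ _) (sym (+-cong (*-identityʳ x) (*-identityʳ y)))
  [x+y]^pᵈ≈x^pᵈ+y^pᵈ {p} p-prime p×1≈0 (suc d) x y = begin
    (x + y) ^ (p ℕ.* p ℕ.^ d)                  ≈⟨ ^-assocʳ (x + y) p (p ℕ.^ d) ⟨
    ((x + y) ^ p) ^ (p ℕ.^ d)                  ≈⟨ ^-congˡ (p ℕ.^ d) ([x+y]^p≈x^p+y^p p-prime p×1≈0 x y) ⟩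
    (x ^ p + y ^ p) ^ (p ℕ.^ d)                ≈⟨ [x+y]^pᵈ≈x^pᵈ+y^pᵈ p-prime p×1≈0 d (x ^ p) (y ^ p) ⟩
    (x ^ p) ^ (p ℕ.^ d) + (y ^ p) ^ (p ℕ.^ d)  ≈⟨ +-cong (^-assocʳ x p _) (^-assocʳ y p _) ⟩
    x ^ (p ℕ.* p ℕ.^ d) + y ^ (p ℕ.* p ℕ.^ d)  ∎

module FiniteField {c ℓ} (R : CommutativeRing c ℓ) (F : IsField R) {q} (card : HasCard R q) where
  open CommutativeRing R
  open IsField F
  open import Algebra.Properties.Semiring.Exp semiring using (_^_)
  open import Algebra.Properties.Semiring.Mult semiring using (_×_; ×1-homo-*)
  open import Algebra.Properties.Monoid.Sum +-monoid using (sum; sum-replicate)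
  open import Algebra.Properties.CommutativeMonoid.Sum +-commutativeMonoid using (∑-distrib-+)
  open import Algebra.Properties.CommutativeMonoid.Sum *-commutativeMonoid using ()
    renaming (sum to ∏; sum-cong-≋ to ∏-cong-≋; sum-remove to ∏-remove; sum-replicate to ∏-replicate;
              ∑-distrib-+ to ∏-distrib-*)
  open import Algebra.Properties.Group +-group using (identityˡ-unique; \\-leftDividesˡ; \\-leftDividesʳ)
  open SetoidReasoning setoid

  private
    enum : Fin q → Carrier
    enum = proj₁ card

    enum-injective : ∀ i j → enum i ≈ enum j → i ≡ j
    enum-injective = proj₁ (proj₂ card)

    index : Carrier → Fin q
    index x = proj₁ (proj₂ (proj₂ card) x)

    enum-index : ∀ x → enum (index x) ≈ x
    enum-index x = proj₂ (proj₂ (proj₂ card) x)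

    index-cong : ∀ {x y} → x ≈ y → index x ≡ index y
    index-cong {x} {y} x≈y = enum-injective _ _ (trans (enum-index x) (trans x≈y (sym (enum-index y))))

    index-enum : ∀ i → index (enum i) ≡ i
    index-enum i = enum-injective _ _ (enum-index (enum i))

  instance
    q-nonZero : NonZero q
    q-nonZero = Fin.nonZeroIndex (index 0#)

  infix 4 _≈?_
  _≈?_ : Decidable _≈_
  x ≈? y with index x Fin.≟ index y
  ... | yes i≡j = yes (trans (sym (enum-index x)) (trans (reflexive (≡.cong enum i≡j)) (enum-index y)))
  ... | no i≢j  = no (i≢j ∘ index-cong)

  module _ {c′ ℓ′} (M : CommutativeMonoid c′ ℓ′) where
    private module M = CommutativeMonoid M
    open import Algebra.Properties.CommutativeMonoid.Sum M using (∑-permute) renaming (sum to ∑)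
    open import Algebra.Properties.Monoid.Sum M.monoid using () renaming (sum-cong-≋ to ∑-cong-≋)
    open import Data.Fin.Permutation using (permutation)

    ∑-reindex : ∀ (w : Carrier → M.Carrier) → Congruent _≈_ M._≈_ w →
                ∀ σ σ⁻¹ → Congruent _≈_ _≈_ σ → Congruent _≈_ _≈_ σ⁻¹ →
                StrictlyInverseˡ _≈_ σ σ⁻¹ → StrictlyInverseʳ _≈_ σ σ⁻¹ →
                ∑ (w ∘ σ ∘ enum) M.≈ ∑ (w ∘ enum)
    ∑-reindex w w-cong σ σ⁻¹ σ-cong σ⁻¹-cong σσ⁻¹ σ⁻¹σ =
      M.trans (∑-cong-≋ (λ i → w-cong (sym (enum-index (σ (enum i))))))
              (M.sym (∑-permute (w ∘ enum) π))
      where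
      π = permutation (λ i → index (σ (enum i))) (λ j → index (σ⁻¹ (enum j)))
            (λ j → ≡.trans (index-cong (trans (σ-cong (enum-index _)) (σσ⁻¹ (enum j)))) (index-enum j))
            (λ i → ≡.trans (index-cong (trans (σ⁻¹-cong (enum-index _)) (σ⁻¹σ (enum i)))) (index-enum i))

  q×x≈0 : ∀ x → q × x ≈ 0#
  q×x≈0 x = identityˡ-unique (q × x) (sum enum) (begin
    q × x + sum enum              ≈⟨ +-congʳ (sum-replicate q) ⟨
    sum {q} (λ _ → x) + sum enum  ≈⟨ ∑-distrib-+ (λ _ → x) enum ⟨
    sum (λ i → x + enum i)        ≈⟨ ∑-reindex +-commutativeMonoid (λ y → y) (λ y≈z → y≈z) (x +_) (- x +_)
                                       +-congˡ +-congˡ (\\-leftDividesˡ x) (\\-leftDividesʳ x) ⟩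
    sum enum                      ∎)

  x≉0∧y≉0⇒x*y≉0 : ∀ {x y} → ¬ x ≈ 0# → ¬ y ≈ 0# → ¬ x * y ≈ 0#
  x≉0∧y≉0⇒x*y≉0 {x} {y} x≉0 y≉0 xy≈0 with inverse x x≉0
  ... | x⁻¹ , xx⁻¹≈1 = y≉0 (begin
    y              ≈⟨ *-identityˡ y ⟨
    1# * y         ≈⟨ *-congʳ (trans (*-comm x⁻¹ x) xx⁻¹≈1) ⟨
    (x⁻¹ * x) * y  ≈⟨ *-assoc x⁻¹ x y ⟩
    x⁻¹ * (x * y)  ≈⟨ *-congˡ xy≈0 ⟩
    x⁻¹ * 0#       ≈⟨ zeroʳ x⁻¹ ⟩
    0#             ∎)

  x^n≈0⇒x≈0 : ∀ {x} n → x ^ n ≈ 0# → x ≈ 0#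
  x^n≈0⇒x≈0 {x} n xⁿ≈0 with x ≈? 0#
  ... | yes x≈0 = x≈0
  ... | no x≉0  = ⊥-elim (x^n≉0 n xⁿ≈0)
    where
    x^n≉0 : ∀ n → ¬ x ^ n ≈ 0#
    x^n≉0 zero    = 0≉1 ∘ sym
    x^n≉0 (suc n) = x≉0∧y≉0⇒x*y≉0 x≉0 (x^n≉0 n)

  x*y≈y⇒x≈1 : ∀ {x y} → ¬ y ≈ 0# → x * y ≈ y → x ≈ 1#
  x*y≈y⇒x≈1 {x} {y} y≉0 xy≈y with inverse y y≉0
  ... | y⁻¹ , yy⁻¹≈1 = begin
    x              ≈⟨ *-identityʳ x ⟨
    x * 1#         ≈⟨ *-congˡ yy⁻¹≈1 ⟨
    x * (y * y⁻¹)  ≈⟨ *-assoc x y y⁻¹ ⟨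
    (x * y) * y⁻¹  ≈⟨ *-congʳ xy≈y ⟩
    y * y⁻¹        ≈⟨ yy⁻¹≈1 ⟩
    1#             ∎

  x*∏≈x^n : ∀ {n} x (t : Fin n → Carrier) i₀ → t i₀ ≈ 1# → (∀ i → i ≢ i₀ → t i ≈ x) →
            x * ∏ t ≈ x ^ n
  x*∏≈x^n {suc n} x t i₀ tᵢ₀≈1 t≈x = begin
    x * ∏ t                              ≈⟨ *-congˡ (∏-remove {i = i₀} t) ⟩
    x * (t i₀ * ∏ (t ∘ Fin.punchIn i₀))  ≈⟨ *-congˡ (*-cong tᵢ₀≈1 (∏-cong-≋ (t≈x _ ∘ Fin.punchInᵢ≢i i₀))) ⟩
    x * (1# * ∏ {n} (λ _ → x))           ≈⟨ *-congˡ (*-identityˡ _) ⟩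
    x * ∏ {n} (λ _ → x)                  ≈⟨ *-congˡ (∏-replicate n) ⟩
    x ^ suc n                            ∎

  private
    unitPart : Carrier → Carrier
    unitPart y = if does (y ≈? 0#) then 1# else y

    unitPart-cong : Congruent _≈_ _≈_ unitPart
    unitPart-cong {y} {z} y≈z with y ≈? 0# | z ≈? 0#
    ... | yes _   | yes _   = refl
    ... | yes y≈0 | no z≉0  = ⊥-elim (z≉0 (trans (sym y≈z) y≈0))
    ... | no y≉0  | yes z≈0 = ⊥-elim (y≉0 (trans y≈z z≈0))
    ... | no _    | no _    = y≈z

    unitPart≉0 : ∀ y → ¬ unitPart y ≈ 0#
    unitPart≉0 y with y ≈? 0#
    ... | yes _  = 0≉1 ∘ sym
    ... | no y≉0 = y≉0

    ∏-unitPart≉0 : ∀ n (f : Fin n → Carrier) → ¬ ∏ (unitPart ∘ f) ≈ 0#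
    ∏-unitPart≉0 zero    f = 0≉1 ∘ sym
    ∏-unitPart≉0 (suc n) f = x≉0∧y≉0⇒x*y≉0 (unitPart≉0 (f Fin.zero)) (∏-unitPart≉0 n (f ∘ Fin.suc))

  -- Multiplication by x permutes the field, so the invertible product ∏ unitPart y over
  -- all y equals ∏ unitPart (x y) = ∏ factor y · ∏ unitPart y.  Hence ∏ factor = 1,
  -- while x · ∏ factor = x^q because factor y is x except at y = 0.
  module _ {x} (x≉0 : ¬ x ≈ 0#) where
    private
      x⁻¹ = proj₁ (inverse x x≉0)
      xx⁻¹≈1 = proj₂ (inverse x x≉0)

      factor : Carrier → Carrier
      factor y = if does (y ≈? 0#) then 1# else x

      unitPart-x* : ∀ y → unitPart (x * y) ≈ factor y * unitPart y
      unitPart-x* y with x * y ≈? 0# | y ≈? 0#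
      ... | yes _    | yes _   = sym (*-identityˡ 1#)
      ... | yes xy≈0 | no y≉0  = ⊥-elim (x≉0∧y≉0⇒x*y≉0 x≉0 y≉0 xy≈0)
      ... | no xy≉0  | yes y≈0 = ⊥-elim (xy≉0 (trans (*-congˡ y≈0) (zeroʳ x)))
      ... | no _     | no _    = refl

      x*[x⁻¹*y]≈y : ∀ y → x * (x⁻¹ * y) ≈ y
      x*[x⁻¹*y]≈y y = trans (sym (*-assoc x x⁻¹ y)) (trans (*-congʳ xx⁻¹≈1) (*-identityˡ y))

      x⁻¹*[x*y]≈y : ∀ y → x⁻¹ * (x * y) ≈ y
      x⁻¹*[x*y]≈y y =
        trans (sym (*-assoc x⁻¹ x y)) (trans (*-congʳ (trans (*-comm x⁻¹ x) xx⁻¹≈1)) (*-identityˡ y))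

      ∏-factor≈1 : ∏ (factor ∘ enum) ≈ 1#
      ∏-factor≈1 = x*y≈y⇒x≈1 (∏-unitPart≉0 q enum) (begin
        ∏ (factor ∘ enum) * ∏ (unitPart ∘ enum)        ≈⟨ ∏-distrib-* (factor ∘ enum) (unitPart ∘ enum) ⟨
        ∏ (λ i → factor (enum i) * unitPart (enum i))  ≈⟨ ∏-cong-≋ (λ i → sym (unitPart-x* (enum i))) ⟩
        ∏ (λ i → unitPart (x * enum i))
          ≈⟨ ∑-reindex *-commutativeMonoid unitPart unitPart-cong
               (x *_) (x⁻¹ *_) *-congˡ *-congˡ x*[x⁻¹*y]≈y x⁻¹*[x*y]≈y ⟩
        ∏ (unitPart ∘ enum)                            ∎)

      factor≈x : ∀ i → i ≢ index 0# → factor (enum i) ≈ x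
      factor≈x i i≢i₀ with enum i ≈? 0#
      ... | yes eᵢ≈0 = ⊥-elim (i≢i₀ (≡.trans (≡.sym (index-enum i)) (index-cong eᵢ≈0)))
      ... | no _     = refl

      factor≈1 : factor (enum (index 0#)) ≈ 1#
      factor≈1 with enum (index 0#) ≈? 0#
      ... | yes _  = refl
      ... | no e≉0 = ⊥-elim (e≉0 (enum-index 0#))

    x≉0⇒x^q≈x : x ^ q ≈ x
    x≉0⇒x^q≈x = begin
      x ^ q                  ≈⟨ x*∏≈x^n x (factor ∘ enum) (index 0#) factor≈1 factor≈x ⟨
      x * ∏ (factor ∘ enum)  ≈⟨ *-congˡ ∏-factor≈1 ⟩
      x * 1#                 ≈⟨ *-identityʳ x ⟩
      x                      ∎

  x^q≈x : ∀ x → x ^ q ≈ x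
  x^q≈x x with x ≈? 0#
  ... | no x≉0  = x≉0⇒x^q≈x x≉0
  ... | yes x≈0 = begin
    x ^ q              ≡⟨ ≡.cong (x ^_) (ℕ.suc-pred q) ⟨
    x * x ^ ℕ.pred q   ≈⟨ *-congʳ x≈0 ⟩
    0# * x ^ ℕ.pred q  ≈⟨ zeroˡ _ ⟩
    0#                 ≈⟨ x≈0 ⟨
    x                  ∎

  p×1≈0 : ∀ p d → q ≡ p ℕ.^ d → p × 1# ≈ 0#
  p×1≈0 p d q≡p^d = x^n≈0⇒x≈0 d (begin
    (p × 1#) ^ d    ≈⟨ pᵈ×1≈[p×1]ᵈ d ⟨
    (p ℕ.^ d) × 1#  ≡⟨ ≡.cong (_× 1#) q≡p^d ⟨
    q × 1#          ≈⟨ q×x≈0 1# ⟩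
    0#              ∎)
    where
    pᵈ×1≈[p×1]ᵈ : ∀ d → (p ℕ.^ d) × 1# ≈ (p × 1#) ^ d
    pᵈ×1≈[p×1]ᵈ zero    = +-identityʳ 1#
    pᵈ×1≈[p×1]ᵈ (suc d) = trans (×1-homo-* p (p ℕ.^ d)) (*-congˡ (pᵈ×1≈[p×1]ᵈ d))

infixr 8 _·ₘ_
_·ₘ_ : ∀ {k} → ℕ → Vec ℕ k → Vec ℕ k
n ·ₘ e = Vec.map (n ℕ.*_) e

infixl 9 _/ₘ_
_/ₘ_ : ∀ {k} → Vec ℕ k → (n : ℕ) → .{{NonZero n}} → Vec ℕ k
e /ₘ n = Vec.map (ℕ._/ n) e

·ₘ-injective : ∀ {k} n .{{_ : NonZero n}} (e e′ : Vec ℕ k) → n ·ₘ e ≡ n ·ₘ e′ → e ≡ e′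
·ₘ-injective n [] [] _ = ≡.refl
·ₘ-injective n (x ∷ e) (y ∷ e′) eq =
  ≡.cong₂ _∷_ (ℕ.*-cancelˡ-≡ x y n (≡.cong Vec.head eq)) (·ₘ-injective n e e′ (≡.cong Vec.tail eq))

e+n·e≡[1+n]·e : ∀ {k} n (e : Vec ℕ k) → zipWith ℕ._+_ e (n ·ₘ e) ≡ suc n ·ₘ e
e+n·e≡[1+n]·e n [] = ≡.refl
e+n·e≡[1+n]·e n (x ∷ e) = ≡.cong (x ℕ.+ n ℕ.* x ∷_) (e+n·e≡[1+n]·e n e)

n·e+e′≡n·m⇒n·[e′/n]≡e′ : ∀ {k} n .{{_ : NonZero n}} (e e′ m : Vec ℕ k) →
                         zipWith ℕ._+_ (n ·ₘ e) e′ ≡ n ·ₘ m → n ·ₘ (e′ /ₘ n) ≡ e′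
n·e+e′≡n·m⇒n·[e′/n]≡e′ n [] [] [] _ = ≡.refl
n·e+e′≡n·m⇒n·[e′/n]≡e′ n (x ∷ e) (y ∷ e′) (z ∷ m) eq =
  ≡.cong₂ _∷_ (ℕ.m*[n/m]≡n n∣y) (n·e+e′≡n·m⇒n·[e′/n]≡e′ n e e′ m (≡.cong Vec.tail eq))
  where
  n∣y : n ∣ y
  n∣y = ℕ.∣m+n∣m⇒∣n (≡.subst (n ∣_) (≡.sym (≡.cong Vec.head eq)) (ℕ.m∣m*n z)) (ℕ.m∣m*n x)

module PolynomialRing {c ℓ} (R : CommutativeRing c ℓ) (l : ℕ) where
  open CommutativeRing R
  open Polys R l
  open import Algebra.Properties.Ring ring using (-1*x≈-x)
  open import Algebra.Properties.Group +-group using (x∙y⁻¹≈ε⇒x≈y)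
  open import Algebra.Properties.CommutativeSemigroup +-commutativeSemigroup using (x∙yz≈y∙xz; interchange)
  open import Algebra.Properties.CommutativeSemigroup *-commutativeSemigroup using ()
    renaming (x∙yz≈y∙xz to x*[y*z]≈y*[x*z])
  open SetoidReasoning setoid

  -- _≈ₚ_ unfolds to a Π-type, from which Agda cannot recover the two polynomials;
  -- the ring is therefore built on this record wrapper, which it can.
  infix 4 _≋_
  record _≋_ (f g : Poly) : Set ℓ where
    constructor ≈ₚ⇒≋
    field ≋⇒≈ₚ : f ≈ₚ g
  open _≋_ public
  open import Algebra.Definitions _≋_
    using (Congruent₁; Congruent₂; Associative; Commutative; LeftIdentity; LeftInverse; _DistributesOverʳ_)

  infixl 6 _⊕_
  _⊕_ : Monomial → Monomial → Monomial
  _⊕_ = zipWith ℕ._+_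

  infix 4 _≟ₘ_
  _≟ₘ_ : (e m : Monomial) → Dec (e ≡ m)
  _≟ₘ_ = Vec.≡-dec ℕ._≟_

  δ : Monomial → Monomial → Carrier
  δ m e = if ⌊ e ≟ₘ m ⌋ then 1# else 0#

  -- Polynomials with the same linExt for every G are equal (take G = δ m), so each ring
  -- law below is checked on linExt of both sides, without ever normalising a polynomial.
  linExt : (Monomial → Carrier) → Poly → Carrier
  linExt G [] = 0#
  linExt G ((a , e) ∷ f) = a * G e + linExt G f

  coeff≈linExt-δ : ∀ f m → coeff f m ≈ linExt (δ m) f
  coeff≈linExt-δ [] m = refl
  coeff≈linExt-δ ((a , e) ∷ f) m with e ≟ₘ m
  ... | yes _ = +-cong (sym (*-identityʳ a)) (coeff≈linExt-δ f m)
  ... | no _  = trans (coeff≈linExt-δ f m) (sym (trans (+-congʳ (zeroʳ a)) (+-identityˡ _)))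

  linExt-congˡ : ∀ {G H} → (∀ e → G e ≈ H e) → ∀ f → linExt G f ≈ linExt H f
  linExt-congˡ G≈H [] = refl
  linExt-congˡ G≈H ((a , e) ∷ f) = +-cong (*-congˡ (G≈H e)) (linExt-congˡ G≈H f)

  linExt-0ˡ : ∀ f → linExt (λ _ → 0#) f ≈ 0#
  linExt-0ˡ [] = refl
  linExt-0ˡ ((a , e) ∷ f) = trans (+-cong (zeroʳ a) (linExt-0ˡ f)) (+-identityˡ 0#)

  linExt-+ˡ : ∀ G H f → linExt (λ e → G e + H e) f ≈ linExt G f + linExt H f
  linExt-+ˡ G H [] = sym (+-identityˡ 0#)
  linExt-+ˡ G H ((a , e) ∷ f) = begin
    a * (G e + H e) + linExt (λ e → G e + H e) f     ≈⟨ +-cong (distribˡ a (G e) (H e)) (linExt-+ˡ G H f) ⟩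
    (a * G e + a * H e) + (linExt G f + linExt H f)  ≈⟨ interchange _ _ _ _ ⟩
    (a * G e + linExt G f) + (a * H e + linExt H f)  ∎

  linExt-*ˡ : ∀ k G f → linExt (λ e → k * G e) f ≈ k * linExt G f
  linExt-*ˡ k G [] = sym (zeroʳ k)
  linExt-*ˡ k G ((a , e) ∷ f) = begin
    a * (k * G e) + linExt (λ e → k * G e) f  ≈⟨ +-cong (x*[y*z]≈y*[x*z] a k (G e)) (linExt-*ˡ k G f) ⟩
    k * (a * G e) + k * linExt G f            ≈⟨ distribˡ k _ _ ⟨
    k * (a * G e + linExt G f)                ∎

  linExt-++ : ∀ G f g → linExt G (f ++ g) ≈ linExt G f + linExt G g
  linExt-++ G [] g = sym (+-identityˡ _)
  linExt-++ G ((a , e) ∷ f) g = trans (+-congˡ (linExt-++ G f g)) (sym (+-assoc _ _ _))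

  linExt-scale : ∀ G k f → linExt G (scale k f) ≈ k * linExt G f
  linExt-scale G k [] = sym (zeroʳ k)
  linExt-scale G k ((a , e) ∷ f) =
    trans (+-cong (*-assoc k a (G e)) (linExt-scale G k f)) (sym (distribˡ k _ _))

  linExt-swap : ∀ (K : Monomial → Monomial → Carrier) f g →
                linExt (λ e → linExt (K e) g) f ≈ linExt (λ e′ → linExt (λ e → K e e′) f) g
  linExt-swap K [] g = sym (linExt-0ˡ g)
  linExt-swap K ((a , e) ∷ f) g = begin
    a * linExt (K e) g + linExt (λ e → linExt (K e) g) f
      ≈⟨ +-cong (sym (linExt-*ˡ a (K e) g)) (linExt-swap K f g) ⟩
    linExt (λ e′ → a * K e e′) g + linExt (λ e′ → linExt (λ e → K e e′) f) g
      ≈⟨ linExt-+ˡ _ _ g ⟨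
    linExt (λ e′ → a * K e e′ + linExt (λ e → K e e′) f) g
      ∎

  mono : Carrier → Monomial → Poly
  mono a e = (a , e) ∷ []

  linExt-mono-*ₚ : ∀ G a e g → linExt G (mono a e *ₚ g) ≈ a * linExt (λ e′ → G (e ⊕ e′)) g
  linExt-mono-*ₚ G a e [] = sym (zeroʳ a)
  linExt-mono-*ₚ G a e ((b , e′) ∷ g) =
    trans (+-cong (*-assoc a b _) (linExt-mono-*ₚ G a e g)) (sym (distribˡ a _ _))

  *ₚ-distribʳ-++ : ∀ f g h → (f ++ g) *ₚ h ≡ (f *ₚ h) ++ (g *ₚ h)
  *ₚ-distribʳ-++ f g h = List.concatMap-++ _ f g

  linExt-*ₚ : ∀ G f g → linExt G (f *ₚ g) ≈ linExt (λ e → linExt (λ e′ → G (e ⊕ e′)) g) f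
  linExt-*ₚ G [] g = refl
  linExt-*ₚ G ((a , e) ∷ f) g = begin
    linExt G (((a , e) ∷ f) *ₚ g)                  ≡⟨ ≡.cong (linExt G) (*ₚ-distribʳ-++ (mono a e) f g) ⟩
    linExt G ((mono a e *ₚ g) ++ (f *ₚ g))         ≈⟨ linExt-++ G (mono a e *ₚ g) (f *ₚ g) ⟩
    linExt G (mono a e *ₚ g) + linExt G (f *ₚ g)   ≈⟨ +-cong (linExt-mono-*ₚ G a e g) (linExt-*ₚ G f g) ⟩
    a * linExt (λ e′ → G (e ⊕ e′)) g + linExt (λ e → linExt (λ e′ → G (e ⊕ e′)) g) f ∎

  coeff-++ : ∀ f g m → coeff (f ++ g) m ≈ coeff f m + coeff g m
  coeff-++ f g m = begin
    coeff (f ++ g) m                 ≈⟨ coeff≈linExt-δ (f ++ g) m ⟩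
    linExt (δ m) (f ++ g)            ≈⟨ linExt-++ (δ m) f g ⟩
    linExt (δ m) f + linExt (δ m) g  ≈⟨ +-cong (coeff≈linExt-δ f m) (coeff≈linExt-δ g m) ⟨
    coeff f m + coeff g m            ∎

  coeff-scale : ∀ k f m → coeff (scale k f) m ≈ k * coeff f m
  coeff-scale k f m = begin
    coeff (scale k f) m       ≈⟨ coeff≈linExt-δ (scale k f) m ⟩
    linExt (δ m) (scale k f)  ≈⟨ linExt-scale (δ m) k f ⟩
    k * linExt (δ m) f        ≈⟨ *-congˡ (coeff≈linExt-δ f m) ⟨
    k * coeff f m             ∎

  without : Monomial → Poly → Poly
  without e [] = []
  without e ((a , e′) ∷ f) = if ⌊ e′ ≟ₘ e ⌋ then without e f else (a , e′) ∷ without e f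

  length-without : ∀ e f → length (without e f) ℕ.≤ length f
  length-without e [] = z≤n
  length-without e ((a , e′) ∷ f) with e′ ≟ₘ e
  ... | yes _ = ℕ.m≤n⇒m≤1+n (length-without e f)
  ... | no _  = s≤s (length-without e f)

  length-without-head : ∀ a e f → length (without e ((a , e) ∷ f)) ℕ.≤ length f
  length-without-head a e f with e ≟ₘ e
  ... | yes _  = length-without e f
  ... | no e≢e = ⊥-elim (e≢e ≡.refl)

  coeff-without-≡ : ∀ e f → coeff (without e f) e ≈ 0#
  coeff-without-≡ e [] = refl
  coeff-without-≡ e ((a , e′) ∷ f) with e′ ≟ₘ e
  ... | yes _ = coeff-without-≡ e f
  ... | no e′≢e with e′ ≟ₘ e
  ...   | yes e′≡e = ⊥-elim (e′≢e e′≡e)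
  ...   | no _     = coeff-without-≡ e f

  coeff-without-≢ : ∀ e f m → e ≢ m → coeff (without e f) m ≈ coeff f m
  coeff-without-≢ e [] m e≢m = refl
  coeff-without-≢ e ((a , e′) ∷ f) m e≢m with e′ ≟ₘ e
  ... | yes ≡.refl with e ≟ₘ m
  ...   | yes e≡m = ⊥-elim (e≢m e≡m)
  ...   | no _    = coeff-without-≢ e f m e≢m
  coeff-without-≢ e ((a , e′) ∷ f) m e≢m | no _ with e′ ≟ₘ m
  ...   | yes _ = +-congˡ (coeff-without-≢ e f m e≢m)
  ...   | no _  = coeff-without-≢ e f m e≢m

  linExt-without : ∀ G e f → linExt G f ≈ coeff f e * G e + linExt G (without e f)
  linExt-without G e [] = sym (trans (+-congʳ (zeroˡ (G e))) (+-identityˡ 0#))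
  linExt-without G e ((a , e′) ∷ f) with e′ ≟ₘ e
  ... | yes ≡.refl = begin
    a * G e + linExt G f                                  ≈⟨ +-congˡ (linExt-without G e f) ⟩
    a * G e + (coeff f e * G e + linExt G (without e f))  ≈⟨ +-assoc _ _ _ ⟨
    (a * G e + coeff f e * G e) + linExt G (without e f)  ≈⟨ +-congʳ (distribʳ (G e) a (coeff f e)) ⟨
    (a + coeff f e) * G e + linExt G (without e f)        ∎
  ... | no _ = begin
    a * G e′ + linExt G f                                  ≈⟨ +-congˡ (linExt-without G e f) ⟩
    a * G e′ + (coeff f e * G e + linExt G (without e f))  ≈⟨ x∙yz≈y∙xz _ _ _ ⟩
    coeff f e * G e + (a * G e′ + linExt G (without e f))  ∎

  ≈ₚ[]⇒linExt≈0 : ∀ G n f → length f ℕ.≤ n → f ≈ₚ [] → linExt G f ≈ 0#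
  ≈ₚ[]⇒linExt≈0 G n [] _ _ = refl
  ≈ₚ[]⇒linExt≈0 G (suc n) f@((a , e) ∷ f′) (s≤s |f′|≤n) f≈0 = begin
    linExt G f                                ≈⟨ linExt-without G e f ⟩
    coeff f e * G e + linExt G (without e f)  ≈⟨ +-cong (trans (*-congʳ (f≈0 e)) (zeroˡ (G e)))
                                                        (≈ₚ[]⇒linExt≈0 G n (without e f) |without|≤n without≈0) ⟩
    0# + 0#                                   ≈⟨ +-identityˡ 0# ⟩
    0#                                        ∎
    where
    |without|≤n = ℕ.≤-trans (length-without-head a e f′) |f′|≤n
    without≈0 : without e f ≈ₚ []
    without≈0 m with e ≟ₘ m
    ... | yes ≡.refl = coeff-without-≡ e f
    ... | no e≢m     = trans (coeff-without-≢ e f m e≢m) (f≈0 m)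

  linExt-congʳ : ∀ G {f g} → f ≋ g → linExt G f ≈ linExt G g
  linExt-congʳ G {f} {g} (≈ₚ⇒≋ f≈g) = x∙y⁻¹≈ε⇒x≈y (linExt G f) (linExt G g) (begin
    linExt G f - linExt G g                 ≈⟨ +-congˡ (-1*x≈-x _) ⟨
    linExt G f + - 1# * linExt G g          ≈⟨ +-congˡ (linExt-scale G (- 1#) g) ⟨
    linExt G f + linExt G (scale (- 1#) g)  ≈⟨ linExt-++ G f (scale (- 1#) g) ⟨
    linExt G (f ++ scale (- 1#) g)          ≈⟨ ≈ₚ[]⇒linExt≈0 G _ (f ++ scale (- 1#) g) ℕ.≤-refl f-g≈0 ⟩
    0#                                      ∎)
    where
    f-g≈0 : (f ++ scale (- 1#) g) ≈ₚ []
    f-g≈0 m = begin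
      coeff (f ++ scale (- 1#) g) m         ≈⟨ coeff-++ f (scale (- 1#) g) m ⟩
      coeff f m + coeff (scale (- 1#) g) m  ≈⟨ +-cong (f≈g m) (trans (coeff-scale (- 1#) g m) (-1*x≈-x _)) ⟩
      coeff g m - coeff g m                 ≈⟨ -‿inverseʳ _ ⟩
      0#                                    ∎

  ≋-isEquivalence : IsEquivalence _≋_
  ≋-isEquivalence = record
    { refl  = ≈ₚ⇒≋ λ _ → refl
    ; sym   = λ (≈ₚ⇒≋ f≈g) → ≈ₚ⇒≋ λ m → sym (f≈g m)
    ; trans = λ (≈ₚ⇒≋ f≈g) (≈ₚ⇒≋ g≈h) → ≈ₚ⇒≋ λ m → trans (f≈g m) (g≈h m)
    }

  ≋-setoid : Setoid c ℓ
  ≋-setoid = record { isEquivalence = ≋-isEquivalence }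

  ≋-reflexive : ∀ {f g} → f ≡ g → f ≋ g
  ≋-reflexive ≡.refl = ≈ₚ⇒≋ λ _ → refl

  linExt-injective : ∀ {f g} → (∀ G → linExt G f ≈ linExt G g) → f ≋ g
  linExt-injective {f} {g} f≈g = ≈ₚ⇒≋ λ m → begin
    coeff f m       ≈⟨ coeff≈linExt-δ f m ⟩
    linExt (δ m) f  ≈⟨ f≈g (δ m) ⟩
    linExt (δ m) g  ≈⟨ coeff≈linExt-δ g m ⟨
    coeff g m       ∎

  0ₚ : Poly
  0ₚ = []

  -ₚ_ : Poly → Poly
  -ₚ f = scale (- 1#) f

  ⊕-comm : ∀ e e′ → e ⊕ e′ ≡ e′ ⊕ e
  ⊕-comm = Vec.zipWith-comm ℕ.+-comm

  ⊕-assoc : ∀ e e′ e″ → e ⊕ e′ ⊕ e″ ≡ e ⊕ (e′ ⊕ e″)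
  ⊕-assoc = Vec.zipWith-assoc ℕ.+-assoc

  ⊕-identityˡ : ∀ e → replicate l 0 ⊕ e ≡ e
  ⊕-identityˡ = Vec.zipWith-identityˡ ℕ.+-identityˡ

  +ₚ-cong : Congruent₂ _+ₚ_
  +ₚ-cong {f} {f′} {g} {g′} (≈ₚ⇒≋ f≈f′) (≈ₚ⇒≋ g≈g′) = ≈ₚ⇒≋ λ m → begin
    coeff (f ++ g) m         ≈⟨ coeff-++ f g m ⟩
    coeff f m + coeff g m    ≈⟨ +-cong (f≈f′ m) (g≈g′ m) ⟩
    coeff f′ m + coeff g′ m  ≈⟨ coeff-++ f′ g′ m ⟨
    coeff (f′ ++ g′) m       ∎

  +ₚ-assoc : Associative _+ₚ_
  +ₚ-assoc f g h = ≋-reflexive (List.++-assoc f g h)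

  +ₚ-comm : Commutative _+ₚ_
  +ₚ-comm f g = ≈ₚ⇒≋ λ m → trans (coeff-++ f g m) (trans (+-comm _ _) (sym (coeff-++ g f m)))

  +ₚ-identityˡ : LeftIdentity 0ₚ _+ₚ_
  +ₚ-identityˡ f = ≈ₚ⇒≋ λ _ → refl

  -ₚ-cong : Congruent₁ -ₚ_
  -ₚ-cong {f} {g} (≈ₚ⇒≋ f≈g) = ≈ₚ⇒≋ λ m →
    trans (coeff-scale (- 1#) f m) (trans (*-congˡ (f≈g m)) (sym (coeff-scale (- 1#) g m)))

  -ₚ-inverseˡ : LeftInverse 0ₚ -ₚ_ _+ₚ_
  -ₚ-inverseˡ f = ≈ₚ⇒≋ λ m → begin
    coeff (-ₚ f ++ f) m         ≈⟨ coeff-++ (-ₚ f) f m ⟩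
    coeff (-ₚ f) m + coeff f m  ≈⟨ +-congʳ (trans (coeff-scale (- 1#) f m) (-1*x≈-x _)) ⟩
    - coeff f m + coeff f m     ≈⟨ -‿inverseˡ _ ⟩
    0#                          ∎

  *ₚ-cong : Congruent₂ _*ₚ_
  *ₚ-cong {f} {f′} {g} {g′} f≋f′ g≋g′ = linExt-injective λ G → begin
    linExt G (f *ₚ g)                                ≈⟨ linExt-*ₚ G f g ⟩
    linExt (λ e → linExt (λ e′ → G (e ⊕ e′)) g) f    ≈⟨ linExt-congʳ _ f≋f′ ⟩
    linExt (λ e → linExt (λ e′ → G (e ⊕ e′)) g) f′   ≈⟨ linExt-congˡ (λ e → linExt-congʳ _ g≋g′) f′ ⟩
    linExt (λ e → linExt (λ e′ → G (e ⊕ e′)) g′) f′  ≈⟨ linExt-*ₚ G f′ g′ ⟨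
    linExt G (f′ *ₚ g′)                              ∎

  *ₚ-comm : Commutative _*ₚ_
  *ₚ-comm f g = linExt-injective λ G → begin
    linExt G (f *ₚ g)
      ≈⟨ linExt-*ₚ G f g ⟩
    linExt (λ e → linExt (λ e′ → G (e ⊕ e′)) g) f
      ≈⟨ linExt-swap (λ e e′ → G (e ⊕ e′)) f g ⟩
    linExt (λ e′ → linExt (λ e → G (e ⊕ e′)) f) g
      ≈⟨ linExt-congˡ (λ e′ → linExt-congˡ (λ e → reflexive (≡.cong G (⊕-comm e e′))) f) g ⟩
    linExt (λ e′ → linExt (λ e → G (e′ ⊕ e)) f) g
      ≈⟨ linExt-*ₚ G g f ⟨
    linExt G (g *ₚ f)
      ∎

  *ₚ-assoc : Associative _*ₚ_
  *ₚ-assoc f g h = linExt-injective λ G → begin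
    linExt G ((f *ₚ g) *ₚ h)
      ≈⟨ linExt-*ₚ G (f *ₚ g) h ⟩
    linExt (λ e → linExt (λ e″ → G (e ⊕ e″)) h) (f *ₚ g)
      ≈⟨ linExt-*ₚ _ f g ⟩
    linExt (λ e → linExt (λ e′ → linExt (λ e″ → G (e ⊕ e′ ⊕ e″)) h) g) f
      ≈⟨ linExt-congˡ (λ e → linExt-congˡ (λ e′ → linExt-congˡ (λ e″ →
           reflexive (≡.cong G (⊕-assoc e e′ e″))) h) g) f ⟩
    linExt (λ e → linExt (λ e′ → linExt (λ e″ → G (e ⊕ (e′ ⊕ e″))) h) g) f
      ≈⟨ linExt-congˡ (λ e → linExt-*ₚ (λ e‴ → G (e ⊕ e‴)) g h) f ⟨
    linExt (λ e → linExt (λ e‴ → G (e ⊕ e‴)) (g *ₚ h)) f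
      ≈⟨ linExt-*ₚ G f (g *ₚ h) ⟨
    linExt G (f *ₚ (g *ₚ h))
      ∎

  *ₚ-identityˡ : LeftIdentity 1ₚ _*ₚ_
  *ₚ-identityˡ f = linExt-injective λ G → begin
    linExt G (1ₚ *ₚ f)                                ≈⟨ linExt-*ₚ G 1ₚ f ⟩
    1# * linExt (λ e → G (replicate l 0 ⊕ e)) f + 0#  ≈⟨ +-identityʳ _ ⟩
    1# * linExt (λ e → G (replicate l 0 ⊕ e)) f       ≈⟨ *-identityˡ _ ⟩
    linExt (λ e → G (replicate l 0 ⊕ e)) f            ≈⟨ linExt-congˡ (reflexive ∘ ≡.cong G ∘ ⊕-identityˡ) f ⟩
    linExt G f                                        ∎

  *ₚ-distribʳ-+ₚ : _*ₚ_ DistributesOverʳ _+ₚ_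
  *ₚ-distribʳ-+ₚ h f g = ≋-reflexive (*ₚ-distribʳ-++ f g h)

  open import Algebra.Consequences.Setoid ≋-setoid using (comm∧idˡ⇒id; comm∧invˡ⇒inv; comm∧distrʳ⇒distr)
  open import Algebra.Structures _≋_ using (IsCommutativeRing)

  +ₚ-*ₚ-isCommutativeRing : IsCommutativeRing _+ₚ_ _*ₚ_ -ₚ_ 0ₚ 1ₚ
  +ₚ-*ₚ-isCommutativeRing = record
    { isRing = record
      { +-isAbelianGroup = record
        { isGroup = record
          { isMonoid = record
            { isSemigroup = record
              { isMagma = record { isEquivalence = ≋-isEquivalence ; ∙-cong = +ₚ-cong }
              ; assoc   = +ₚ-assoc
              }
            ; identity = comm∧idˡ⇒id +ₚ-comm +ₚ-identityˡ
            }
          ; inverse = comm∧invˡ⇒inv +ₚ-comm -ₚ-inverseˡ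
          ; ⁻¹-cong = -ₚ-cong
          }
        ; comm = +ₚ-comm
        }
      ; *-cong     = *ₚ-cong
      ; *-assoc    = *ₚ-assoc
      ; *-identity = comm∧idˡ⇒id *ₚ-comm *ₚ-identityˡ
      ; distrib    = comm∧distrʳ⇒distr +ₚ-cong *ₚ-comm *ₚ-distribʳ-+ₚ
      }
    ; *-comm = *ₚ-comm
    }

  +ₚ-*ₚ-commutativeRing : CommutativeRing c ℓ
  +ₚ-*ₚ-commutativeRing = record { isCommutativeRing = +ₚ-*ₚ-isCommutativeRing }

module PolynomialRingProperties {c ℓ} (R : CommutativeRing c ℓ) (l : ℕ) where
  open CommutativeRing R
  open Polys R l
  open PolynomialRing R l
  private module S = CommutativeRing +ₚ-*ₚ-commutativeRing
  open import Algebra.Properties.Semiring.Exp semiring using () renaming (_^_ to _^ᴿ_)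
  open import Algebra.Properties.Semiring.Exp S.semiring public using (_^_)
  open import Algebra.Properties.Semiring.Exp S.semiring using (^-congˡ)
  open import Algebra.Properties.CommutativeSemiring.Exp S.commutativeSemiring using (^-distrib-*)
  open SetoidReasoning S.setoid

  ^ₚ≡^ : ∀ f n → f ^ₚ n ≡ f ^ n
  ^ₚ≡^ f zero    = ≡.refl
  ^ₚ≡^ f (suc n) = ≡.cong (f *ₚ_) (^ₚ≡^ f n)

  mono-cong : ∀ {a b e e′} → a ≈ b → e ≡ e′ → mono a e ≋ mono b e′
  mono-cong a≈b ≡.refl = linExt-injective λ G → +-congʳ (*-congʳ a≈b)

  mono-^ : ∀ a e n → mono a e ^ n ≋ mono (a ^ᴿ n) (n ·ₘ e)
  mono-^ a e zero    = mono-cong refl (≡.sym (Vec.map-const e 0))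
  mono-^ a e (suc n) = begin
    mono a e *ₚ (mono a e ^ n)          ≈⟨ S.*-congˡ {x = mono a e} (mono-^ a e n) ⟩
    mono a e *ₚ mono (a ^ᴿ n) (n ·ₘ e)  ≈⟨ mono-cong refl (e+n·e≡[1+n]·e n e) ⟩
    mono (a ^ᴿ suc n) (suc n ·ₘ e)      ∎

  scale-cong : ∀ a {f g} → f ≋ g → scale a f ≋ scale a g
  scale-cong a {f} {g} (≈ₚ⇒≋ f≈g) = ≈ₚ⇒≋ λ m →
    trans (coeff-scale a f m) (trans (*-congˡ (f≈g m)) (sym (coeff-scale a g m)))

  ∑ₚ : ∀ {k} → (Fin k → Poly) → Poly
  ∑ₚ fs = List.concat (List.tabulate fs)

  ∑ₚ-cong : ∀ {k} {fs gs : Fin k → Poly} → (∀ i → fs i ≋ gs i) → ∑ₚ fs ≋ ∑ₚ gs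
  ∑ₚ-cong {zero}  fs≋gs = S.refl
  ∑ₚ-cong {suc k} fs≋gs = S.+-cong (fs≋gs Fin.zero) (∑ₚ-cong (fs≋gs ∘ Fin.suc))

  applyLin-cong : ∀ {θ θ′} → θ ≈D θ′ → ∀ a → applyLin θ a ≋ applyLin θ′ a
  applyLin-cong θ≈θ′ a = ∑ₚ-cong λ i → scale-cong (a i) (≈ₚ⇒≋ (θ≈θ′ i))

  ∣ₚ-resp : ∀ {a a′ b b′} → a ≋ a′ → b ≋ b′ → a ∣ₚ b → a′ ∣ₚ b′
  ∣ₚ-resp {a} {a′} {b} {b′} a≋a′ b≋b′ (g , b≈ag) = g , ≋⇒≈ₚ (begin
    b′       ≈⟨ b≋b′ ⟨
    b        ≈⟨ ≈ₚ⇒≋ b≈ag ⟩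
    a *ₚ g   ≈⟨ S.*-congʳ {x = g} a≋a′ ⟩
    a′ *ₚ g  ∎)

  ∣ₚ-^ : ∀ n a b → a ∣ₚ b → (a ^ n) ∣ₚ (b ^ n)
  ∣ₚ-^ n a b (g , b≈ag) = g ^ n , ≋⇒≈ₚ (begin
    b ^ n               ≈⟨ ^-congˡ n (≈ₚ⇒≋ b≈ag) ⟩
    (a *ₚ g) ^ n        ≈⟨ ^-distrib-* a g n ⟩
    (a ^ n) *ₚ (g ^ n)  ∎)

module Frobenius {c ℓ} (R : CommutativeRing c ℓ) (F : IsField R) {q} (card : HasCard R q)
                 {p} (p-prime : Prime p) (d : ℕ) (q≡p^d : q ≡ p ℕ.^ d) (l : ℕ) where
  open CommutativeRing R
  open Polys R l
  open PolynomialRing R l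
  open PolynomialRingProperties R l
  open FiniteField R F card using (q-nonZero; x^q≈x; p×1≈0)
  open FreshmansDream commutativeSemiring using (p×x≈0)
  open import Algebra.Properties.Semiring.Exp semiring using () renaming (_^_ to _^ᴿ_)
  open import Algebra.Properties.Semiring.Mult semiring using (_×_)
  private module S = CommutativeRing +ₚ-*ₚ-commutativeRing
  open import Algebra.Properties.Semiring.Exp S.semiring using (^-assocʳ)
  open import Algebra.Properties.CommutativeSemiring.Exp S.commutativeSemiring using (^-distrib-*)
  open import Algebra.Properties.Semiring.Mult S.semiring using () renaming (_×_ to _×ₛ_)
  open FreshmansDream S.commutativeSemiring using ([x+y]^pᵈ≈x^pᵈ+y^pᵈ)

  p×1ₚ≋0ₚ : p ×ₛ 1ₚ ≋ 0ₚ
  p×1ₚ≋0ₚ = ≈ₚ⇒≋ λ m → trans (coeff-× p 1ₚ m) (p×x≈0 p (p×1≈0 p d q≡p^d) _)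
    where
    coeff-× : ∀ n f m → coeff (n ×ₛ f) m ≈ n × coeff f m
    coeff-× zero    f m = refl
    coeff-× (suc n) f m = trans (coeff-++ f (n ×ₛ f) m) (+-congˡ (coeff-× n f m))

  [f+g]^q≋f^q+g^q : ∀ f g → (f +ₚ g) ^ q ≋ (f ^ q) +ₚ (g ^ q)
  [f+g]^q≋f^q+g^q f g rewrite q≡p^d = [x+y]^pᵈ≈x^pᵈ+y^pᵈ p-prime p×1ₚ≋0ₚ d f g

  frobenius : Poly → Poly
  frobenius = List.map λ (a , e) → (a , q ·ₘ e)

  ^q≋frobenius : ∀ f → f ^ q ≋ frobenius f
  -- With q = suc (pred q), 0ₚ ^ q reduces to 0ₚ.
  ^q≋frobenius [] = ≋-reflexive (≡.cong (0ₚ ^_) (≡.sym (ℕ.suc-pred q)))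
  ^q≋frobenius ((a , e) ∷ f) = begin
    (mono a e +ₚ f) ^ q                    ≈⟨ [f+g]^q≋f^q+g^q (mono a e) f ⟩
    (mono a e ^ q) +ₚ (f ^ q)              ≈⟨ S.+-cong (mono-^ a e q) (^q≋frobenius f) ⟩
    mono (a ^ᴿ q) (q ·ₘ e) +ₚ frobenius f  ≈⟨ S.+-congʳ {x = frobenius f} (mono-cong (x^q≈x a) ≡.refl) ⟩
    mono a (q ·ₘ e) +ₚ frobenius f         ∎
    where open SetoidReasoning S.setoid

  φ≋frobenius : ∀ f → φ q f ≋ frobenius f
  φ≋frobenius f = S.trans (≋-reflexive (^ₚ≡^ f q)) (^q≋frobenius f)

  coeff-frobenius : ∀ f e → coeff (frobenius f) (q ·ₘ e) ≈ coeff f e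
  coeff-frobenius [] e = refl
  coeff-frobenius ((a , e′) ∷ f) e with q ·ₘ e′ ≟ₘ q ·ₘ e | e′ ≟ₘ e
  ... | yes _      | yes _    = +-congˡ (coeff-frobenius f e)
  ... | yes qe′≡qe | no e′≢e  = ⊥-elim (e′≢e (·ₘ-injective q e′ e qe′≡qe))
  ... | no qe′≢qe  | yes e′≡e = ⊥-elim (qe′≢qe (≡.cong (q ·ₘ_) e′≡e))
  ... | no _       | no _     = coeff-frobenius f e

  ^q-injective : ∀ f g → (∀ e → coeff (f ^ q) (q ·ₘ e) ≈ coeff (g ^ q) (q ·ₘ e)) → f ≋ g
  ^q-injective f g f^q≈g^q = ≈ₚ⇒≋ λ e → begin
    coeff f e                     ≈⟨ coeff-frobenius f e ⟨
    coeff (frobenius f) (q ·ₘ e)  ≈⟨ ≋⇒≈ₚ (^q≋frobenius f) (q ·ₘ e) ⟨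
    coeff (f ^ q) (q ·ₘ e)        ≈⟨ f^q≈g^q e ⟩
    coeff (g ^ q) (q ·ₘ e)        ≈⟨ ≋⇒≈ₚ (^q≋frobenius g) (q ·ₘ e) ⟩
    coeff (frobenius g) (q ·ₘ e)  ≈⟨ coeff-frobenius g e ⟩
    coeff g e                     ∎
    where open SetoidReasoning setoid

  root : Poly → Poly
  root [] = []
  root ((a , e) ∷ f) = if ⌊ q ·ₘ (e /ₘ q) ≟ₘ e ⌋ then (a , e /ₘ q) ∷ root f else root f

  linExt-frobenius : ∀ G f → linExt G (frobenius f) ≡ linExt (λ e → G (q ·ₘ e)) f
  linExt-frobenius G [] = ≡.refl
  linExt-frobenius G ((a , e) ∷ f) = ≡.cong (a * G (q ·ₘ e) +_) (linExt-frobenius G f)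

  linExt-frobenius-root : ∀ G → (∀ e → q ·ₘ (e /ₘ q) ≢ e → G e ≈ 0#) →
                          ∀ h → linExt G h ≈ linExt G (frobenius (root h))
  linExt-frobenius-root G G≈0 [] = refl
  linExt-frobenius-root G G≈0 ((a , e) ∷ h) with q ·ₘ (e /ₘ q) ≟ₘ e
  ... | yes q[e/q]≡e =
    +-cong (*-congˡ (reflexive (≡.cong G (≡.sym q[e/q]≡e)))) (linExt-frobenius-root G G≈0 h)
  ... | no q[e/q]≢e  =
    trans (+-cong (trans (*-congˡ (G≈0 e q[e/q]≢e)) (zeroʳ a)) (linExt-frobenius-root G G≈0 h)) (+-identityˡ _)

  coeff-frobenius-*ₚ : ∀ g h e →
    coeff (frobenius g *ₚ h) (q ·ₘ e) ≈ coeff (frobenius g *ₚ frobenius (root h)) (q ·ₘ e)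
  coeff-frobenius-*ₚ g h e = begin
    coeff (frobenius g *ₚ h) m
      ≈⟨ coeff≈linExt-δ (frobenius g *ₚ h) m ⟩
    linExt (δ m) (frobenius g *ₚ h)
      ≈⟨ linExt-*ₚ (δ m) (frobenius g) h ⟩
    linExt (λ e′ → linExt (λ e″ → δ m (e′ ⊕ e″)) h) (frobenius g)
      ≡⟨ linExt-frobenius _ g ⟩
    linExt (λ e′ → linExt (λ e″ → δ m (q ·ₘ e′ ⊕ e″)) h) g
      ≈⟨ linExt-congˡ (λ e′ → linExt-frobenius-root _ (δ-vanishes e′) h) g ⟩
    linExt (λ e′ → linExt (λ e″ → δ m (q ·ₘ e′ ⊕ e″)) (frobenius (root h))) g
      ≡⟨ linExt-frobenius _ g ⟨
    linExt (λ e′ → linExt (λ e″ → δ m (e′ ⊕ e″)) (frobenius (root h))) (frobenius g)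
      ≈⟨ linExt-*ₚ (δ m) (frobenius g) (frobenius (root h)) ⟨
    linExt (δ m) (frobenius g *ₚ frobenius (root h))
      ≈⟨ coeff≈linExt-δ (frobenius g *ₚ frobenius (root h)) m ⟨
    coeff (frobenius g *ₚ frobenius (root h)) m
      ∎
    where
    open SetoidReasoning setoid
    m = q ·ₘ e
    δ-vanishes : ∀ e′ e″ → q ·ₘ (e″ /ₘ q) ≢ e″ → δ m (q ·ₘ e′ ⊕ e″) ≈ 0#
    δ-vanishes e′ e″ q∤e″ with q ·ₘ e′ ⊕ e″ ≟ₘ m
    ... | yes qe′+e″≡qe = ⊥-elim (q∤e″ (n·e+e′≡n·m⇒n·[e′/n]≡e′ q e′ e″ e qe′+e″≡qe))
    ... | no _          = refl

  ^q-cancel : ∀ a b h → b ^ q ≋ (a ^ q) *ₚ h → b ≋ a *ₚ root h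
  ^q-cancel a b h b^q≋a^q*h = ^q-injective b (a *ₚ root h) λ e → begin
    coeff (b ^ q) (q ·ₘ e)
      ≈⟨ ≋⇒≈ₚ b^q≋a^q*h (q ·ₘ e) ⟩
    coeff ((a ^ q) *ₚ h) (q ·ₘ e)
      ≈⟨ ≋⇒≈ₚ (S.*-congʳ {x = h} (^q≋frobenius a)) (q ·ₘ e) ⟩
    coeff (frobenius a *ₚ h) (q ·ₘ e)
      ≈⟨ coeff-frobenius-*ₚ a h e ⟩
    coeff (frobenius a *ₚ frobenius (root h)) (q ·ₘ e)
      ≈⟨ ≋⇒≈ₚ (S.*-cong (^q≋frobenius a) (^q≋frobenius (root h))) (q ·ₘ e) ⟨
    coeff ((a ^ q) *ₚ (root h ^ q)) (q ·ₘ e)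
      ≈⟨ ≋⇒≈ₚ (^-distrib-* a (root h) q) (q ·ₘ e) ⟨
    coeff ((a *ₚ root h) ^ q) (q ·ₘ e)
      ∎
    where open SetoidReasoning setoid

  ^q-∣ₚ-cancel : ∀ a b → (a ^ q) ∣ₚ (b ^ q) → a ∣ₚ b
  ^q-∣ₚ-cancel a b (h , b^q≈a^q*h) = root h , ≋⇒≈ₚ (^q-cancel a b h (≈ₚ⇒≋ b^q≈a^q*h))

  ^ₚ-^q : ∀ f μ → (f ^ₚ μ) ^ q ≋ f ^ₚ (q ℕ.* μ)
  ^ₚ-^q f μ = begin
    (f ^ₚ μ) ^ q    ≡⟨ ≡.cong (_^ q) (^ₚ≡^ f μ) ⟩
    (f ^ μ) ^ q     ≈⟨ ^-assocʳ f μ q ⟩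
    f ^ (μ ℕ.* q)   ≡⟨ ≡.cong (f ^_) (ℕ.*-comm μ q) ⟩
    f ^ (q ℕ.* μ)   ≡⟨ ^ₚ≡^ f (q ℕ.* μ) ⟨
    f ^ₚ (q ℕ.* μ)  ∎
    where open SetoidReasoning S.setoid

  frobenius-scale : ∀ a f → frobenius (scale a f) ≡ scale a (frobenius f)
  frobenius-scale a [] = ≡.refl
  frobenius-scale a ((b , e) ∷ f) = ≡.cong ((a * b , q ·ₘ e) ∷_) (frobenius-scale a f)

  frobenius-∑ₚ : ∀ {k} (fs : Fin k → Poly) → frobenius (∑ₚ fs) ≡ ∑ₚ (frobenius ∘ fs)
  frobenius-∑ₚ {zero}  fs = ≡.refl
  frobenius-∑ₚ {suc k} fs = ≡.trans (List.map-++ _ (fs Fin.zero) (∑ₚ (fs ∘ Fin.suc)))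
                                    (≡.cong (frobenius (fs Fin.zero) ++_) (frobenius-∑ₚ (fs ∘ Fin.suc)))

  applyLin-φDer : ∀ θ a → applyLin (φDer q θ) a ≋ applyLin θ a ^ q
  applyLin-φDer θ a = begin
    applyLin (φDer q θ) a
      ≈⟨ applyLin-cong (λ i → ≋⇒≈ₚ (φ≋frobenius (θ i))) a ⟩
    applyLin (frobenius ∘ θ) a
      ≡⟨ ≡.cong List.concat (List.tabulate-cong (λ i → frobenius-scale (a i) (θ i))) ⟨
    ∑ₚ (λ i → frobenius (scale (a i) (θ i)))
      ≡⟨ frobenius-∑ₚ (λ i → scale (a i) (θ i)) ⟨
    frobenius (applyLin θ a)
      ≈⟨ ^q≋frobenius (applyLin θ a) ⟨
    applyLin θ a ^ q
      ∎
    where open SetoidReasoning S.setoid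

  InD⇔InD-φDer : ∀ {n} (α : Fin n → LinForm) μ η θ → φDer q η ≈D θ →
                 InD α μ η ⇔ InD α (λ H → q ℕ.* μ H) θ
  InD⇔InD-φDer α μ η θ φη≈θ = mk⇔
    (λ η∈D H → ∣ₚ-resp (^ₚ-^q (A H) (μ H)) (ηα^q≋θα H) (∣ₚ-^ q (A H ^ₚ μ H) (ηα H) (η∈D H)))
    (λ θ∈D H → ^q-∣ₚ-cancel (A H ^ₚ μ H) (ηα H)
                 (∣ₚ-resp (S.sym (^ₚ-^q (A H) (μ H))) (S.sym (ηα^q≋θα H)) (θ∈D H)))
    where
    A = linPoly ∘ α
    ηα = λ H → applyLin η (α H)
    ηα^q≋θα : ∀ H → ηα H ^ q ≋ applyLin θ (α H)
    ηα^q≋θα H = S.trans (S.sym (applyLin-φDer η (α H))) (applyLin-cong φη≈θ (α H))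

open import Data.Nat using (_*_)
open import Data.Product using (_×_)

lemma2p1 : ∀ {c ℓ : Level} (R : CommutativeRing c ℓ) → IsField R →
    (q : ℕ) → IsPrimePower q → HasCard R q →
    (l n : ℕ) (α : Fin n → Polys.LinForm R l) →
    (∀ H → Polys.NonZeroForm R l (α H)) →
    (∀ H H′ → Polys.Proportional R l (α H) (α H′) → H ≡ H′) →
    (μ : Fin n → ℕ) → (θ : Polys.Der R l) →
    Polys.InφD R l q α μ θ
      ⇔ (Polys.InD R l α (λ H → q * μ H) θ × Polys.InImφ R l q θ)
lemma2p1 R F q (p , d , p-prime , _ , q≡p^d) card l n α _ _ μ θ = mk⇔
  (λ (η , η∈D , φη≈θ) → Equivalence.to (InD⇔InD-φDer α μ η θ φη≈θ) η∈D , η , φη≈θ)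
  (λ (θ∈D , η , φη≈θ) → η , Equivalence.from (InD⇔InD-φDer α μ η θ φη≈θ) θ∈D , φη≈θ)
  where open Frobenius R F card p-prime d q≡p^d l
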